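{- Let $s[x]$ and $t[y]$ be reduced, non-ground and non-trivial terms with $x\neq y$ and $s[x]\neq t[x]$. If $s$ and $t$ have a unifier $\sigma$, then $x\sigma,y\sigma\in U[V]$. Here $U$ is the set of non-ground (possibly trivial) strict subterms of $s$ and $t$, and $V$ is the set of ground strict subterms of $s$ and $t$.
   Context: Terms are first-order terms over a signature of function symbols and variables. - A term is ground if it contains no variables, and trivial if it contains no function symbols, i.e. it is a variable. - $M[x_1,\dots,x_n]$ means that the variables of $M$ are among $x_1,\dots,x_n$. For a term $u[z]$ containing at most one variable $z$, $u[v]$ denotes $u$ with $z$ replaced by $v$. $s[x]$ is a term with at most the variable $x$, and $s[y]$ denotes the same term with $x$ renamed to $y$. - For sets of such terms, $U[V]=\{u[v]\mid u\in U,v\in V\}$. - A one-variable term is a term containing at most one variable. - A non-ground one-variable term $t[x]$ is reduced if it is not of the form $u[v[x]]$ for any non-ground, non-trivial one-variable terms $u[x]$ and $v[x]$. -}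

module Defs where

open import Data.Nat using (ℕ)
open import Data.Fin using (Fin)
open import Data.Vec using (Vec; []; _∷_; lookup)
open import Data.Product using (Σ; ∃; _×_; _,_)
open import Data.Sum using (_⊎_)
open import Relation.Nullary using (¬_)
open import Relation.Binary.PropositionalEquality using (_≡_)

data Term {F : Set} (ar : F → ℕ) : Set where
  var : ℕ → Term ar
  fun : (f : F) → Vec (Term ar) (ar f) → Term ar

module _ {F : Set} {ar : F → ℕ} where

  Subst : Set
  Subst = ℕ → Term ar

  mutual
    _⟨_⟩ : Term ar → Subst → Term ar
    var z ⟨ σ ⟩ = σ z
    fun f ts ⟨ σ ⟩ = fun f (ts ⟨ σ ⟩*)

    _⟨_⟩* : ∀ {n} → Vec (Term ar) n → Subst → Vec (Term ar) n
    [] ⟨ σ ⟩* = []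
    (t ∷ ts) ⟨ σ ⟩* = (t ⟨ σ ⟩) ∷ (ts ⟨ σ ⟩*)

  data Occurs (z : ℕ) : Term ar → Set where
    here : Occurs z (var z)
    arg  : ∀ {f ts} (i : Fin (ar f)) → Occurs z (lookup ts i) → Occurs z (fun f ts)

  Ground : Term ar → Set
  Ground t = ∀ z → ¬ Occurs z t

  Trivial : Term ar → Set
  Trivial t = ∃ λ z → t ≡ var z

  OneVar : Term ar → Set
  OneVar t = ∀ a b → Occurs a t → Occurs b t → a ≡ b

  -- M[x]: the variables of M are among {x}
  VarsAmong₁ : Term ar → ℕ → Set
  VarsAmong₁ t x = ∀ z → Occurs z t → z ≡ x

  -- u[v] for a one-variable term u: replace its (unique, if any) variable by v
  plug : Term ar → Term ar → Term ar
  plug u v = u ⟨ (λ _ → v) ⟩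

  Reduced : Term ar → Set
  Reduced t = OneVar t × ¬ Ground t ×
    ¬ (Σ (Term ar) λ u → Σ (Term ar) λ v →
         OneVar u × ¬ Ground u × ¬ Trivial u ×
         OneVar v × ¬ Ground v × ¬ Trivial v ×
         t ≡ plug u v)

  data _⊑_ (u : Term ar) : Term ar → Set where
    refl⊑ : u ⊑ u
    arg⊑  : ∀ {f ts} (i : Fin (ar f)) → u ⊑ lookup ts i → u ⊑ fun f ts

  data _⊏_ (u : Term ar) : Term ar → Set where
    arg⊏ : ∀ {f ts} (i : Fin (ar f)) → u ⊑ lookup ts i → u ⊏ fun f ts

  InU : Term ar → Term ar → Term ar → Set
  InU s t u = (u ⊏ s ⊎ u ⊏ t) × ¬ Ground u

  InV : Term ar → Term ar → Term ar → Set
  InV s t v = (v ⊏ s ⊎ v ⊏ t) × Ground v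

  InUV : Term ar → Term ar → Term ar → Set
  InUV s t w = Σ (Term ar) λ u → Σ (Term ar) λ v →
    InU s t u × InV s t v × w ≡ plug u v

-- Walk down s and t in parallel along their common instance sσ = tσ. Since s ≠ t[x], the walk
-- meets a variable of one term opposite a non-variable subterm w of the other, say σx = wσ with
-- w ⊑ t. If w is ground, σx ∈ V. Otherwise w = w[y], and s[w] is a one-variable term in y with
-- s[w]σ = tσ; it differs from t because t is reduced, so a second walk, in which the occurs check
-- rules out non-ground bindings, makes σy a ground subterm of s or t. Finally, once σx ∈ V, the
-- strict subterm σy of tσ = s[σx] either lies inside σx or is u[σx] for a strict subterm u of s.
module Submission where

open import Defs
open import Data.Nat using (ℕ; suc; _+_; _≤_; _<_; s≤s)
open import Data.Nat.Properties using (≤-refl; ≤-trans; <-irrefl; m≤m+n; m≤n+m; n≤1+n)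
open import Data.Fin using (Fin; zero; suc)
open import Data.Vec using (Vec; []; _∷_; lookup)
open import Data.Vec.Properties using (∷-injective)
open import Data.Product using (Σ; ∃; _×_; _,_)
import Data.Product as Prod
open import Data.Sum using (_⊎_; inj₁; inj₂)
import Data.Sum as Sum
open import Data.Empty using (⊥-elim)
open import Relation.Nullary using (¬_)
open import Relation.Binary.PropositionalEquality
  using (_≡_; _≢_; refl; sym; trans; cong; cong₂; subst; module ≡-Reasoning)

module _ {F : Set} {ar : F → ℕ} where

  private
    Tm : Set
    Tm = Term ar

    Sub : Set
    Sub = Subst {ar = ar}

    variable
      s t u v w a b c : Tm
      σ ρ : Sub
      x y z n : ℕ

  fun-injective : ∀ {f g} {us : Vec Tm (ar f)} {vs : Vec Tm (ar g)} → fun f us ≡ fun g vs →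
                  Σ (f ≡ g) λ e → subst (λ h → Vec Tm (ar h)) e us ≡ vs
  fun-injective refl = refl , refl

  lookup-⟨⟩* : (ts : Vec Tm n) (i : Fin n) → lookup (ts ⟨ σ ⟩*) i ≡ lookup ts i ⟨ σ ⟩
  lookup-⟨⟩* (t ∷ ts) zero = refl
  lookup-⟨⟩* (t ∷ ts) (suc i) = lookup-⟨⟩* ts i

  lookup-≡-⟨⟩* : ∀ {cs as : Vec Tm n} (i : Fin n) → cs ≡ as ⟨ σ ⟩* → lookup cs i ≡ lookup as i ⟨ σ ⟩
  lookup-≡-⟨⟩* {as = as} i refl = lookup-⟨⟩* as i

  mutual
    ⟨⟩-cong : (t : Tm) → (∀ z → Occurs z t → σ z ≡ ρ z) → t ⟨ σ ⟩ ≡ t ⟨ ρ ⟩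
    ⟨⟩-cong (var z) h = h z here
    ⟨⟩-cong (fun f ts) h = cong (fun f) (⟨⟩*-cong ts (λ i z o → h z (arg i o)))

    ⟨⟩*-cong : (ts : Vec Tm n) → (∀ i z → Occurs z (lookup ts i) → σ z ≡ ρ z) →
               ts ⟨ σ ⟩* ≡ ts ⟨ ρ ⟩*
    ⟨⟩*-cong [] h = refl
    ⟨⟩*-cong (t ∷ ts) h = cong₂ _∷_ (⟨⟩-cong t (h zero)) (⟨⟩*-cong ts (λ i → h (suc i)))

  mutual
    ⟨var⟩ : (t : Tm) → t ⟨ var ⟩ ≡ t
    ⟨var⟩ (var z) = refl
    ⟨var⟩ (fun f ts) = cong (fun f) (⟨var⟩* ts)

    ⟨var⟩* : (ts : Vec Tm n) → ts ⟨ var ⟩* ≡ ts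
    ⟨var⟩* [] = refl
    ⟨var⟩* (t ∷ ts) = cong₂ _∷_ (⟨var⟩ t) (⟨var⟩* ts)

  mutual
    ⟨⟩-⟨⟩ : (t : Tm) (σ ρ : Sub) → t ⟨ σ ⟩ ⟨ ρ ⟩ ≡ t ⟨ (λ z → σ z ⟨ ρ ⟩) ⟩
    ⟨⟩-⟨⟩ (var z) σ ρ = refl
    ⟨⟩-⟨⟩ (fun f ts) σ ρ = cong (fun f) (⟨⟩*-⟨⟩* ts σ ρ)

    ⟨⟩*-⟨⟩* : (ts : Vec Tm n) (σ ρ : Sub) → ts ⟨ σ ⟩* ⟨ ρ ⟩* ≡ ts ⟨ (λ z → σ z ⟨ ρ ⟩) ⟩*
    ⟨⟩*-⟨⟩* [] σ ρ = refl
    ⟨⟩*-⟨⟩* (t ∷ ts) σ ρ = cong₂ _∷_ (⟨⟩-⟨⟩ t σ ρ) (⟨⟩*-⟨⟩* ts σ ρ)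

  ground-⟨⟩ : Ground t → t ⟨ σ ⟩ ≡ t
  ground-⟨⟩ {t} g = trans (⟨⟩-cong t (λ z o → ⊥-elim (g z o))) (⟨var⟩ t)

  plug-⟨⟩ : (s w : Tm) (σ : Sub) → plug s w ⟨ σ ⟩ ≡ plug s (w ⟨ σ ⟩)
  plug-⟨⟩ s w = ⟨⟩-⟨⟩ s (λ _ → w)

  ⟨⟩-varsAmong₁ : VarsAmong₁ s x → s ⟨ σ ⟩ ≡ plug s (σ x)
  ⟨⟩-varsAmong₁ {s} {σ = σ} hs = ⟨⟩-cong s (λ z o → cong σ (hs z o))

  varsAmong₁⇒oneVar : VarsAmong₁ u z → OneVar u
  varsAmong₁⇒oneVar h a b oa ob = trans (h a oa) (sym (h b ob))

  plug-var-varsAmong₁ : VarsAmong₁ s x → plug s (var x) ≡ s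
  plug-var-varsAmong₁ {s} hs = trans (sym (⟨⟩-varsAmong₁ hs)) (⟨var⟩ s)

  Occurs-⟨⟩ : Occurs z a → Occurs y (σ z) → Occurs y (a ⟨ σ ⟩)
  Occurs-⟨⟩ here o′ = o′
  Occurs-⟨⟩ {y = y} {σ = σ} (arg {ts = ts} i o) o′ =
    arg i (subst (Occurs y) (sym (lookup-⟨⟩* ts i)) (Occurs-⟨⟩ o o′))

  Occurs-⟨⟩⁻ : (a : Tm) → Occurs y c → c ≡ a ⟨ σ ⟩ → ∃ λ z → Occurs z a × Occurs y (σ z)
  Occurs-⟨⟩⁻ {y} (var z) o e = z , here , subst (Occurs y) e o
  Occurs-⟨⟩⁻ (fun f as) (arg i o) e with fun-injective e
  ... | refl , e′ with Occurs-⟨⟩⁻ (lookup as i) o (lookup-≡-⟨⟩* i e′)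
  ... | z , oz , oy = z , arg i oz , oy

  plug-varsAmong₁ : (s : Tm) → VarsAmong₁ w y → VarsAmong₁ (plug s w) y
  plug-varsAmong₁ s hw z o with Occurs-⟨⟩⁻ s o refl
  ... | _ , _ , ow = hw z ow

  mutual
    ground-or-occurs : (t : Tm) → Ground t ⊎ ∃ λ z → Occurs z t
    ground-or-occurs (var z) = inj₂ (z , here)
    ground-or-occurs (fun f ts) with ground-or-occurs* ts
    ... | inj₁ g = inj₁ (λ { z (arg i o) → g i z o })
    ... | inj₂ (i , z , o) = inj₂ (z , arg i o)

    ground-or-occurs* : (ts : Vec Tm n) →
      (∀ i z → ¬ Occurs z (lookup ts i)) ⊎ ∃ λ i → ∃ λ z → Occurs z (lookup ts i)
    ground-or-occurs* [] = inj₁ (λ ())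
    ground-or-occurs* (t ∷ ts) with ground-or-occurs t | ground-or-occurs* ts
    ... | inj₂ (z , o) | _             = inj₂ (zero , z , o)
    ... | inj₁ _       | inj₂ (i , z , o) = inj₂ (suc i , z , o)
    ... | inj₁ g       | inj₁ h        = inj₁ (λ { zero → g ; (suc i) → h i })

  ¬ground⇒occurs : ¬ Ground t → ∃ λ z → Occurs z t
  ¬ground⇒occurs {t} ng = Sum.[ (λ g → ⊥-elim (ng g)) , (λ o → o) ]′ (ground-or-occurs t)

  fun-nontrivial : ∀ {f} {ts : Vec Tm (ar f)} → ¬ Trivial (fun f ts)
  fun-nontrivial (_ , ())

  ⊑-trans : u ⊑ v → v ⊑ w → u ⊑ w
  ⊑-trans p refl⊑ = p
  ⊑-trans p (arg⊑ i q) = arg⊑ i (⊑-trans p q)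

  ⊑-⊏-trans : u ⊑ v → v ⊏ w → u ⊏ w
  ⊑-⊏-trans p (arg⊏ i q) = arg⊏ i (⊑-trans p q)

  ⊏⇒⊑ : u ⊏ v → u ⊑ v
  ⊏⇒⊑ (arg⊏ i q) = arg⊑ i q

  ⊑⇒≡⊎⊏ : u ⊑ v → u ≡ v ⊎ u ⊏ v
  ⊑⇒≡⊎⊏ refl⊑ = inj₁ refl
  ⊑⇒≡⊎⊏ (arg⊑ i q) = inj₂ (arg⊏ i q)

  ⊑-Occurs : u ⊑ v → Occurs z u → Occurs z v
  ⊑-Occurs refl⊑ o = o
  ⊑-Occurs (arg⊑ i q) o = arg i (⊑-Occurs q o)

  ⊑-ground : u ⊑ v → Ground v → Ground u
  ⊑-ground p g z o = g z (⊑-Occurs p o)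

  ⊑-varsAmong₁ : u ⊑ v → VarsAmong₁ v x → VarsAmong₁ u x
  ⊑-varsAmong₁ p h z o = h z (⊑-Occurs p o)

  ground-⊑⇒⊏ : u ⊑ v → Ground u → ¬ Ground v → u ⊏ v
  ground-⊑⇒⊏ p gu ngv with ⊑⇒≡⊎⊏ p
  ... | inj₁ refl = ⊥-elim (ngv gu)
  ... | inj₂ q = q

  Occurs⇒var⊑ : Occurs z t → var z ⊑ t
  Occurs⇒var⊑ here = refl⊑
  Occurs⇒var⊑ (arg i o) = arg⊑ i (Occurs⇒var⊑ o)

  Occurs⇒var⊏ : Occurs z t → ¬ Trivial t → var z ⊏ t
  Occurs⇒var⊏ {z} o nt with ⊑⇒≡⊎⊏ (Occurs⇒var⊑ o)
  ... | inj₁ e = ⊥-elim (nt (z , sym e))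
  ... | inj₂ p = p

  varsAmong₁⇒var⊏ : VarsAmong₁ t x → ¬ Ground t → ¬ Trivial t → var x ⊏ t
  varsAmong₁⇒var⊏ h ng nt with ¬ground⇒occurs ng
  ... | z , o with h z o
  ... | refl = Occurs⇒var⊏ o nt

  ⊑-⟨⟩ : u ⊑ v → (u ⟨ σ ⟩) ⊑ (v ⟨ σ ⟩)
  ⊑-⟨⟩ refl⊑ = refl⊑
  ⊑-⟨⟩ {u = u} {σ = σ} (arg⊑ {ts = ts} i q) =
    arg⊑ i (subst ((u ⟨ σ ⟩) ⊑_) (sym (lookup-⟨⟩* ts i)) (⊑-⟨⟩ q))

  ⊏-⟨⟩ : u ⊏ v → (u ⟨ σ ⟩) ⊏ (v ⟨ σ ⟩)
  ⊏-⟨⟩ {u = u} {σ = σ} (arg⊏ {ts = ts} i q) =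
    arg⊏ i (subst ((u ⟨ σ ⟩) ⊑_) (sym (lookup-⟨⟩* ts i)) (⊑-⟨⟩ q))

  mutual
    size : Tm → ℕ
    size (var _) = 1
    size (fun f ts) = suc (size* ts)

    size* : Vec Tm n → ℕ
    size* [] = 0
    size* (t ∷ ts) = size t + size* ts

  size-lookup : (ts : Vec Tm n) (i : Fin n) → size (lookup ts i) ≤ size* ts
  size-lookup (t ∷ ts) zero = m≤m+n _ _
  size-lookup (t ∷ ts) (suc i) = ≤-trans (size-lookup ts i) (m≤n+m _ _)

  ⊑-size : u ⊑ v → size u ≤ size v
  ⊑-size refl⊑ = ≤-refl
  ⊑-size (arg⊑ {ts = ts} i q) = ≤-trans (⊑-size q) (≤-trans (size-lookup ts i) (n≤1+n _))

  ⊏-size : u ⊏ v → size u < size v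
  ⊏-size (arg⊏ {ts = ts} i q) = s≤s (≤-trans (⊑-size q) (size-lookup ts i))

  ⊏-irrefl : ¬ (u ⊏ u)
  ⊏-irrefl p = <-irrefl refl (⊏-size p)

  occurs-check : Occurs z w → ¬ Trivial w → σ z ≢ w ⟨ σ ⟩
  occurs-check {z} {w} {σ} o nt e with ⊑⇒≡⊎⊏ (Occurs⇒var⊑ o)
  ... | inj₁ e′ = nt (z , sym e′)
  ... | inj₂ p = ⊏-irrefl (subst (_⊏ (w ⟨ σ ⟩)) e (⊏-⟨⟩ p))

  ⊑-⟨⟩⁻ : (a : Tm) → u ⊑ c → c ≡ a ⟨ σ ⟩ →
          (∃ λ z → Occurs z a × u ⊑ σ z) ⊎ (Σ Tm λ a′ → a′ ⊑ a × u ≡ a′ ⟨ σ ⟩)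
  ⊑-⟨⟩⁻ {u} (var z) p e = inj₁ (z , here , subst (u ⊑_) e p)
  ⊑-⟨⟩⁻ (fun f as) refl⊑ e = inj₂ (fun f as , refl⊑ , e)
  ⊑-⟨⟩⁻ (fun f as) (arg⊑ i q) e with fun-injective e
  ... | refl , e′ with ⊑-⟨⟩⁻ (lookup as i) q (lookup-≡-⟨⟩* i e′)
  ... | inj₁ (z , oz , r) = inj₁ (z , arg i oz , r)
  ... | inj₂ (a′ , pa , r) = inj₂ (a′ , arg⊑ i pa , r)

  ground-⊑-plug : (s : Tm) → ¬ Ground w → u ⊑ plug s w → Ground u → u ⊑ s ⊎ u ⊑ w
  ground-⊑-plug {w} s ngw p gu with ⊑-⟨⟩⁻ s p refl
  ... | inj₁ (_ , _ , q) = inj₂ q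
  ... | inj₂ (a , pa , refl) with ground-or-occurs a
  ...   | inj₁ ga = inj₁ (subst (_⊑ s) (sym (ground-⟨⟩ ga)) pa)
  ...   | inj₂ (z , o) with ¬ground⇒occurs ngw
  ...     | y , ow = ⊥-elim (gu y (Occurs-⟨⟩ o ow))

  BindsToSubterm : Sub → ℕ → Tm → Set
  BindsToSubterm σ z b = Σ Tm λ w → w ⊑ b × ¬ Trivial w × σ z ≡ w ⟨ σ ⟩

  Disagreement : Sub → ℕ → ℕ → Tm → Tm → Set
  Disagreement σ x y a b = BindsToSubterm σ x b ⊎ BindsToSubterm σ y a

  BindsToSubterm-⊑ : b ⊑ c → BindsToSubterm σ z b → BindsToSubterm σ z c
  BindsToSubterm-⊑ p (w , pw , ntw , e) = w , ⊑-trans pw p , ntw , e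

  Disagreement-⊑ : a ⊑ u → b ⊑ v → Disagreement σ x y a b → Disagreement σ x y u v
  Disagreement-⊑ pa pb = Sum.map (BindsToSubterm-⊑ pb) (BindsToSubterm-⊑ pa)

  mutual
    unifier-disagreement : (a b : Tm) → VarsAmong₁ a x → VarsAmong₁ b y → a ⟨ σ ⟩ ≡ b ⟨ σ ⟩ →
                           a ≡ plug b (var x) ⊎ Disagreement σ x y a b
    unifier-disagreement (var z) (var w) ha hb e with ha z here | hb w here
    ... | refl | refl = inj₁ refl
    unifier-disagreement (var z) b@(fun _ _) ha hb e with ha z here
    ... | refl = inj₂ (inj₁ (b , refl⊑ , fun-nontrivial , e))
    unifier-disagreement a@(fun _ _) (var w) ha hb e with hb w here
    ... | refl = inj₂ (inj₂ (a , refl⊑ , fun-nontrivial , sym e))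
    unifier-disagreement (fun f as) (fun g bs) ha hb e with fun-injective e
    ... | refl , e′ =
      Sum.map (cong (fun f)) (λ (i , d) → Disagreement-⊑ (arg⊑ i refl⊑) (arg⊑ i refl⊑) d)
        (unifier-disagreement* as bs (λ i z o → ha z (arg i o)) (λ i z o → hb z (arg i o)) e′)

    unifier-disagreement* : (as bs : Vec Tm n) →
      (∀ i → VarsAmong₁ (lookup as i) x) → (∀ i → VarsAmong₁ (lookup bs i) y) →
      as ⟨ σ ⟩* ≡ bs ⟨ σ ⟩* →
      as ≡ bs ⟨ (λ _ → var x) ⟩* ⊎ ∃ λ i → Disagreement σ x y (lookup as i) (lookup bs i)
    unifier-disagreement* [] [] ha hb e = inj₁ refl
    unifier-disagreement* (a ∷ as) (b ∷ bs) ha hb e with ∷-injective e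
    ... | e₁ , e₂ with unifier-disagreement a b (ha zero) (hb zero) e₁
    ... | inj₂ d = inj₂ (zero , d)
    ... | inj₁ a≡b = Sum.map (cong₂ _∷_ a≡b) (λ (i , d) → suc i , d)
                       (unifier-disagreement* as bs (λ i → ha (suc i)) (λ i → hb (suc i)) e₂)

  binding-ground : VarsAmong₁ b z → BindsToSubterm σ z b → Σ Tm λ g → g ⊑ b × Ground g × σ z ≡ g
  binding-ground hb (w , pw , ntw , e) with ground-or-occurs w
  ... | inj₁ gw = w , pw , gw , trans e (ground-⟨⟩ gw)
  ... | inj₂ (z , o) with hb z (⊑-Occurs pw o)
  ... | refl = ⊥-elim (occurs-check o ntw e)

  same-var-unifier-ground : VarsAmong₁ a y → VarsAmong₁ b y → a ≢ b → a ⟨ σ ⟩ ≡ b ⟨ σ ⟩ →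
                            Σ Tm λ g → (g ⊑ a ⊎ g ⊑ b) × Ground g × σ y ≡ g
  same-var-unifier-ground {a} {b = b} ha hb a≢b e with unifier-disagreement a b ha hb e
  ... | inj₁ a≡b = ⊥-elim (a≢b (trans a≡b (plug-var-varsAmong₁ hb)))
  ... | inj₂ (inj₁ d) = Prod.map₂ (Prod.map₁ inj₂) (binding-ground hb d)
  ... | inj₂ (inj₂ d) = Prod.map₂ (Prod.map₁ inj₁) (binding-ground ha d)

  InV-⊑ : u ⊑ s ⊎ u ⊑ t → Ground u → ¬ Ground s → ¬ Ground t → InV s t u
  InV-⊑ p gu ngs ngt = Sum.map (λ q → ground-⊑⇒⊏ q gu ngs) (λ q → ground-⊑⇒⊏ q gu ngt) p , gu

  InV-⊒ : u ⊑ v → InV s t v → InV s t u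
  InV-⊒ q (p , g) = Sum.map (⊑-⊏-trans q) (⊑-⊏-trans q) p , ⊑-ground q g

  InV-swap : InV t s v → InV s t v
  InV-swap = Prod.map₁ Sum.swap

  InUV-swap : InUV t s w → InUV s t w
  InUV-swap (u , v , pu , pv , e) = u , v , Prod.map₁ Sum.swap pu , InV-swap pv , e

  InV⇒InUV : var z ⊏ s → InV s t v → InUV s t v
  InV⇒InUV {z} z⊏s pv = var z , _ , (inj₁ z⊏s , λ g → g z here) , pv , refl

  ⊏-plug-InV⇒InUV : var z ⊏ s → InV s t v → u ⊏ plug s v → InUV s t u
  ⊏-plug-InV⇒InUV {s = s} {t = t} {v = v} z⊏s pv p with ⊑-⟨⟩⁻ s (⊏⇒⊑ p) refl
  ... | inj₁ (_ , _ , u⊑v) = InV⇒InUV z⊏s (InV-⊒ u⊑v pv)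
  ... | inj₂ (a , pa , refl) with ⊑⇒≡⊎⊏ pa
  ...   | inj₁ refl = ⊥-elim (⊏-irrefl p)
  ...   | inj₂ a⊏s with ground-or-occurs a
  ...     | inj₁ ga = InV⇒InUV z⊏s (subst (InV s t) (sym (ground-⟨⟩ ga)) (inj₁ a⊏s , ga))
  ...     | inj₂ (y , o) = a , v , (inj₁ a⊏s , λ g → g y o) , pv , refl

  binding-into-reduced : VarsAmong₁ s x → VarsAmong₁ t y → ¬ Ground s → ¬ Trivial s → Reduced t →
                         s ⟨ σ ⟩ ≡ t ⟨ σ ⟩ → w ⊑ t → ¬ Ground w → ¬ Trivial w → σ x ≡ w ⟨ σ ⟩ →
                         InV s t (σ y)
  binding-into-reduced {s} {x} {t} {y} {σ} {w} hs ht ngs nts (_ , ngt , irreducible) e w⊑t ngw ntw σx≡ =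
    to-InV (same-var-unifier-ground (plug-varsAmong₁ s hw) ht s[w]≢t s[w]σ≡tσ)
    where
    open ≡-Reasoning

    hw : VarsAmong₁ w y
    hw = ⊑-varsAmong₁ w⊑t ht

    s[w]≢t : plug s w ≢ t
    s[w]≢t eq = irreducible (s , w , varsAmong₁⇒oneVar hs , ngs , nts , varsAmong₁⇒oneVar hw , ngw , ntw , sym eq)

    s[w]σ≡tσ : plug s w ⟨ σ ⟩ ≡ t ⟨ σ ⟩
    s[w]σ≡tσ = begin
      plug s w ⟨ σ ⟩     ≡⟨ plug-⟨⟩ s w σ ⟩
      plug s (w ⟨ σ ⟩)   ≡⟨ cong (plug s) σx≡ ⟨
      plug s (σ x)       ≡⟨ ⟨⟩-varsAmong₁ hs ⟨
      s ⟨ σ ⟩            ≡⟨ e ⟩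
      t ⟨ σ ⟩            ∎

    to-InV : (Σ Tm λ g → (g ⊑ plug s w ⊎ g ⊑ t) × Ground g × σ y ≡ g) → InV s t (σ y)
    to-InV (g , inj₁ g⊑s[w] , gg , refl) =
      InV-⊑ (Sum.map₂ (λ g⊑w → ⊑-trans g⊑w w⊑t) (ground-⊑-plug s ngw g⊑s[w] gg)) gg ngs ngt
    to-InV (g , inj₂ g⊑t , gg , refl) = InV-⊑ (inj₂ g⊑t) gg ngs ngt

  binding-InV : VarsAmong₁ s x → VarsAmong₁ t y → Reduced s → Reduced t → ¬ Trivial s →
                s ⟨ σ ⟩ ≡ t ⟨ σ ⟩ → BindsToSubterm σ x t → InV s t (σ x) ⊎ InV s t (σ y)
  binding-InV {s} {t = t} hs ht (_ , ngs , _) rt@(_ , ngt , _) nts e (w , w⊑t , ntw , σx≡)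
    with ground-or-occurs w
  ... | inj₁ gw = inj₁ (subst (InV s t) (sym (trans σx≡ (ground-⟨⟩ gw))) (InV-⊑ (inj₂ w⊑t) gw ngs ngt))
  ... | inj₂ (z , o) = inj₂ (binding-into-reduced hs ht ngs nts rt e w⊑t (λ g → g z o) ntw σx≡)

  unifier-InV : VarsAmong₁ s x → VarsAmong₁ t y → Reduced s → Reduced t → ¬ Trivial s → ¬ Trivial t →
                s ≢ plug t (var x) → s ⟨ σ ⟩ ≡ t ⟨ σ ⟩ → InV s t (σ x) ⊎ InV s t (σ y)
  unifier-InV {s} {t = t} hs ht rs rt nts ntt s≢t e with unifier-disagreement s t hs ht e
  ... | inj₁ s≡t = ⊥-elim (s≢t s≡t)
  ... | inj₂ (inj₁ d) = binding-InV hs ht rs rt nts e d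
  ... | inj₂ (inj₂ d) = Sum.swap (Sum.map InV-swap InV-swap (binding-InV ht hs rt rs ntt (sym e) d))

  InV⇒InUV-both : VarsAmong₁ s x → VarsAmong₁ t y → ¬ Ground s → ¬ Ground t → ¬ Trivial s → ¬ Trivial t →
                  s ⟨ σ ⟩ ≡ t ⟨ σ ⟩ → InV s t (σ x) → InUV s t (σ x) × InUV s t (σ y)
  InV⇒InUV-both {s} {x} {t} {y} {σ} hs ht ngs ngt nts ntt e σx∈V =
    InV⇒InUV x⊏s σx∈V , ⊏-plug-InV⇒InUV x⊏s σx∈V σy⊏s[σx]
    where
    x⊏s : var x ⊏ s
    x⊏s = varsAmong₁⇒var⊏ hs ngs nts

    σy⊏s[σx] : σ y ⊏ plug s (σ x)
    σy⊏s[σx] = subst (σ y ⊏_) (trans (sym e) (⟨⟩-varsAmong₁ hs)) (⊏-⟨⟩ (varsAmong₁⇒var⊏ ht ngt ntt))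

lemma2 : {F : Set} {ar : F → ℕ} (s t : Term ar) (x y : ℕ) →
    VarsAmong₁ s x → VarsAmong₁ t y →
    Reduced s → Reduced t → ¬ Ground s → ¬ Ground t → ¬ Trivial s → ¬ Trivial t →
    x ≢ y → s ≢ plug t (var x) →
    (σ : Subst) → s ⟨ σ ⟩ ≡ t ⟨ σ ⟩ →
    InUV s t (σ x) × InUV s t (σ y)
lemma2 s t x y hs ht rs rt ngs ngt nts ntt _ s≢t σ e with unifier-InV hs ht rs rt nts ntt s≢t e
... | inj₁ σx∈V = InV⇒InUV-both hs ht ngs ngt nts ntt e σx∈V
... | inj₂ σy∈V =
  Prod.swap (Prod.map InUV-swap InUV-swap (InV⇒InUV-both ht hs ngt ngs ntt nts (sym e) (InV-swap σy∈V)))
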